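{- Let $G=(V,E)$ be a graph, $c\ge1$, $\epsilon\in[0,1/3)$, and let $\kappa(G)$ be an $(\epsilon,c)$-kernel of $G$. If $M$ is a maximal matching in $\kappa(G)$, then $M$ is a $(4+6\epsilon)$-approximation to the maximum matching in $G$, i.e., every matching of $G$ has at most $(4+6\epsilon)|M|$ edges.
   Context: For $v\in V$ let $\mathcal{N}_v$ be its neighbors in $G$. A subgraph $\kappa(G)=(V,\kappa(E))$ with $\kappa(E)\subseteq E$, together with a partition of $V$ into a set $\kappa_T(V)$ of tight nodes and a set $\kappa_S(V)$ of slack nodes, is an $(\epsilon,c)$-kernel of $G$ if, writing $\kappa(\mathcal{N}_v)=\{u\in\mathcal{N}_v:(u,v)\in\kappa(E)\}$ (the friends of $v$): (i) $|\kappa(\mathcal{N}_v)|\le(1+\epsilon)c$ for all $v\in V$; (ii) $|\kappa(\mathcal{N}_v)|\ge(1-\epsilon)c$ for all $v\in\kappa_T(V)$; (iii) for all $u,v\in\kappa_S(V)$ with $(u,v)\in E$, we have $(u,v)\in\kappa(E)$.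
   Formalization: The kernel parameters ε and c range over the rationals, with c ≥ 1 and 0 ≤ ε < 1/3. -}

module Defs where

open import Data.Nat using (ℕ)
open import Data.Bool using (Bool; true; false; if_then_else_; not)
open import Data.Fin using (Fin)
open import Data.Nat.ListAction using (sum)
open import Data.List using (List; []; _∷_; map; length; concatMap; allFin)
open import Data.List.Relation.Unary.All using (All)
open import Data.List.Relation.Unary.Any using (Any)
open import Data.List.Relation.Unary.Unique.Propositional using (Unique)
open import Data.List.Membership.Propositional using (_∈_)
open import Data.Product using (_×_; _,_; proj₁; proj₂)
open import Data.Sum using (_⊎_)
open import Data.Integer using (+_)
open import Data.Rational using (ℚ; _/_; _+_; _-_; _*_; _≤_; 1ℚ)
open import Relation.Binary.PropositionalEquality using (_≡_)
open import Relation.Nullary using (¬_)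

record Graph (n : ℕ) : Set where
  field
    adj   : Fin n → Fin n → Bool
    sym   : ∀ u v → adj u v ≡ adj v u
    irrefl : ∀ v → adj v v ≡ false
open Graph public

ℕ→ℚ : ℕ → ℚ
ℕ→ℚ k = (+ k) / 1

degree : ∀ {n} → (Fin n → Fin n → Bool) → Fin n → ℕ
degree {n} a v = sum (map (λ u → if a v u then 1 else 0) (allFin n))

record Kernel {n : ℕ} (G : Graph n) (ε c : ℚ) : Set where
  field
    κ       : Graph n
    sub     : ∀ u v → adj κ u v ≡ true → adj G u v ≡ true
    tight   : Fin n → Bool
    upper   : ∀ v → ℕ→ℚ (degree (adj κ) v) ≤ (1ℚ + ε) * c
    lower   : ∀ v → tight v ≡ true → (1ℚ - ε) * c ≤ ℕ→ℚ (degree (adj κ) v)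
    slackE  : ∀ u v → tight u ≡ false → tight v ≡ false →
              adj G u v ≡ true → adj κ u v ≡ true
open Kernel public

endpoints : ∀ {n} → List (Fin n × Fin n) → List (Fin n)
endpoints = concatMap (λ e → proj₁ e ∷ proj₂ e ∷ [])

-- M is a matching of H: every listed pair is an edge of H, and all
-- endpoints are pairwise distinct (edges are vertex-disjoint; no repeats).
IsMatching : ∀ {n} → Graph n → List (Fin n × Fin n) → Set
IsMatching H M = All (λ e → adj H (proj₁ e) (proj₂ e) ≡ true) M × Unique (endpoints M)

-- M is a maximal matching of H: a matching such that every edge of H
-- has an endpoint covered by M (no edge of H can be added to M).
IsMaximalMatching : ∀ {n} → Graph n → List (Fin n × Fin n) → Set
IsMaximalMatching H M =
  IsMatching H M ×
  (∀ u v → adj H u v ≡ true → (u ∈ endpoints M) ⊎ (v ∈ endpoints M))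

-- Let T be the tight vertices left unmatched by M. By maximality every κ-neighbour of a
-- vertex of T is matched, so double counting the κ-edges between T and the 2|M| matched
-- vertices gives |T|(1-ε)c ≤ 2|M|(1+ε)c, i.e. |T| ≤ 2|M|(1+3ε) when ε < 1/3. An edge of
-- G between two unmatched slack vertices would be a κ-edge extending M, so the matched
-- vertices together with T cover G, and any matching of G has at most 2|M| + |T| edges.
module Submission where

open import Defs renaming (sym to adj-sym)
open import Data.Nat using (ℕ)
open import Data.List using (List; length)
open import Data.Fin using (Fin)
open import Data.Product using (_×_)

module ListSum where

  open import Data.Nat using (zero; suc; _+_; _≤_; _<_; z≤n; s≤s)
  open import Data.Nat.Properties
    using (+-mono-≤; +-monoʳ-≤; +-commutativeSemigroup; module ≤-Reasoning)
  open import Algebra.Properties.CommutativeSemigroup +-commutativeSemigroup using (interchange)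
  open import Data.Nat.ListAction using (sum)
  open import Data.Nat.ListAction.Properties using (sum-↭)
  open import Data.List using ([]; _∷_; _++_; map)
  open import Data.List.Properties using (map-cong)
  open import Data.List.Membership.Propositional using (_∈_)
  open import Data.List.Membership.Propositional.Properties using (∈-∃++)
  open import Data.List.Relation.Binary.Permutation.Propositional using (_↭_)
  open import Data.List.Relation.Binary.Permutation.Propositional.Properties
    using (shift; map⁺; ∈-resp-↭)
  import Data.List.Relation.Unary.All as All
  open import Data.List.Relation.Unary.Any using (here; there)
  open import Data.List.Relation.Unary.AllPairs using (_∷_)
  open import Data.List.Relation.Unary.Unique.Propositional using (Unique)
  open import Data.Product using (∃-syntax; _,_)
  open import Function using (_∘_)
  open import Relation.Binary.PropositionalEquality
  open import Relation.Nullary using (contradiction)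

  private variable X Y : Set

  ∑ : List X → (X → ℕ) → ℕ
  ∑ A f = sum (map f A)

  ∑-cong : (A : List X) {f g : X → ℕ} → (∀ x → f x ≡ g x) → ∑ A f ≡ ∑ A g
  ∑-cong A f≗g = cong sum (map-cong f≗g A)

  ∑-mono : (A : List X) {f g : X → ℕ} → (∀ {x} → x ∈ A → f x ≤ g x) → ∑ A f ≤ ∑ A g
  ∑-mono []      f≤g = z≤n
  ∑-mono (x ∷ A) f≤g = +-mono-≤ (f≤g (here refl)) (∑-mono A (f≤g ∘ there))

  ∑-const-0 : (A : List X) → ∑ A (λ _ → 0) ≡ 0
  ∑-const-0 []      = refl
  ∑-const-0 (x ∷ A) = ∑-const-0 A

  ∑-const-1 : (A : List X) → ∑ A (λ _ → 1) ≡ length A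
  ∑-const-1 []      = refl
  ∑-const-1 (x ∷ A) = cong suc (∑-const-1 A)

  ∑-+ : (A : List X) (f g : X → ℕ) → ∑ A (λ x → f x + g x) ≡ ∑ A f + ∑ A g
  ∑-+ []      f g = refl
  ∑-+ (x ∷ A) f g =
    trans (cong (f x + g x +_) (∑-+ A f g)) (interchange (f x) (g x) (∑ A f) (∑ A g))

  ∑-swap : (A : List X) (B : List Y) (h : X → Y → ℕ) →
           ∑ A (λ x → ∑ B (h x)) ≡ ∑ B (λ y → ∑ A (λ x → h x y))
  ∑-swap []      B h = sym (∑-const-0 B)
  ∑-swap (x ∷ A) B h =
    trans (cong (∑ B (h x) +_) (∑-swap A B h)) (sym (∑-+ B (h x) _))

  ∈⇒↭∷ : ∀ {x} {B : List X} → x ∈ B → ∃[ B′ ] B ↭ x ∷ B′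
  ∈⇒↭∷ x∈B with B₁ , B₂ , refl ← ∈-∃++ x∈B = B₁ ++ B₂ , shift _ B₁ B₂

  ∑-≤-of-support : ∀ {A B : List X} (f : X → ℕ) → Unique A →
                   (∀ {x} → x ∈ A → 0 < f x → x ∈ B) → ∑ A f ≤ ∑ B f
  ∑-≤-of-support {A = []}    f _ _ = z≤n
  ∑-≤-of-support {A = x ∷ A} {B} f (x∉A ∷ uniqueA) supp with f x in fx
  ... | zero  = ∑-≤-of-support f uniqueA (supp ∘ there)
  ... | suc k with B′ , B↭x∷B′ ← ∈⇒↭∷ (supp (here refl) (subst (0 <_) (sym fx) (s≤s z≤n))) =
    begin
      suc k + ∑ A f  ≤⟨ +-monoʳ-≤ (suc k) (∑-≤-of-support f uniqueA supp′) ⟩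
      suc k + ∑ B′ f ≡⟨ cong (_+ ∑ B′ f) fx ⟨
      ∑ (x ∷ B′) f   ≡⟨ sum-↭ (map⁺ f B↭x∷B′) ⟨
      ∑ B f          ∎
    where
    open ≤-Reasoning
    supp′ : ∀ {y} → y ∈ A → 0 < f y → y ∈ B′
    supp′ y∈A fy>0 with ∈-resp-↭ B↭x∷B′ (supp (there y∈A) fy>0)
    ... | here refl = contradiction refl (All.lookup x∉A y∈A)
    ... | there y∈B′ = y∈B′

module MatchingCounting {n : ℕ} where

  open import Data.Nat using (suc; _+_; _≤_; _<_; z≤n; s≤s)
  open import Data.Nat.Properties
    using (≤-refl; ≤-reflexive; ≤-trans; +-assoc; +-suc; +-mono-≤; m≤n+m; module ≤-Reasoning)
  open import Data.Bool using (Bool; true; if_then_else_)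
  open import Data.Fin using (_≟_)
  open import Data.List using ([]; _∷_; allFin)
  open import Data.List.Membership.Propositional using (_∈_; _∉_)
  open import Data.List.Membership.Propositional.Properties using (∈-allFin)
  open import Data.List.Membership.DecPropositional (_≟_ {n}) using (_∈?_)
  open import Data.List.Relation.Unary.All as All using (All; []; _∷_)
  open import Data.List.Relation.Unary.Unique.Propositional using (Unique)
  open import Data.List.Relation.Unary.Unique.Propositional.Properties using (allFin⁺)
  open import Data.Product using (_,_)
  open import Data.Sum using (_⊎_; inj₁; inj₂)
  open import Relation.Binary.PropositionalEquality
  open import Relation.Nullary using (yes; no; does; contradiction)
  open ListSum

  indicator : Bool → ℕ
  indicator b = if b then 1 else 0

  indicator-pos : ∀ {b} → 0 < indicator b → b ≡ true
  indicator-pos {true} _ = refl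

  ∑degree-mono : (H : Graph n) {A B : List (Fin n)} → Unique A →
                 (∀ {v u} → v ∈ A → adj H v u ≡ true → u ∈ B) →
                 ∑ A (degree (adj H)) ≤ ∑ B (degree (adj H))
  ∑degree-mono H {A} {B} uniqueA neighbours⊆B = begin
    ∑ A (λ v → ∑ all (e v))
      ≤⟨ ∑-mono A (λ v∈A → ∑-≤-of-support (e _) (allFin⁺ n)
                              (λ _ e>0 → neighbours⊆B v∈A (indicator-pos e>0))) ⟩
    ∑ A (λ v → ∑ B (e v))
      ≡⟨ ∑-swap A B e ⟩
    ∑ B (λ u → ∑ A (λ v → e v u))
      ≡⟨ ∑-cong B (λ u → ∑-cong A (λ v → cong indicator (adj-sym H v u))) ⟩
    ∑ B (λ u → ∑ A (e u))
      ≤⟨ ∑-mono B (λ _ → ∑-≤-of-support (e _) uniqueA (λ {v} _ _ → ∈-allFin v)) ⟩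
    ∑ B (λ u → ∑ all (e u)) ∎
    where
    open ≤-Reasoning
    all : List (Fin n)
    all = allFin n
    e : Fin n → Fin n → ℕ
    e v u = indicator (adj H v u)

  length-endpoints : (M : List (Fin n × Fin n)) → length (endpoints M) ≡ length M + length M
  length-endpoints []      = refl
  length-endpoints (e ∷ M) =
    cong suc (trans (cong suc (length-endpoints M)) (sym (+-suc (length M) (length M))))

  maximal⇒neighbour-matched : ∀ {H : Graph n} {M u v} → IsMaximalMatching H M →
                              v ∉ endpoints M → adj H v u ≡ true → u ∈ endpoints M
  maximal⇒neighbour-matched (_ , maximal) v∉M vu∈H with maximal _ _ vu∈H
  ... | inj₁ v∈M = contradiction v∈M v∉M
  ... | inj₂ u∈M = u∈M

  module _ (C : List (Fin n)) where

    inC : Fin n → ℕ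
    inC v = indicator (does (v ∈? C))

    inC-pos : ∀ {v} → 0 < inC v → v ∈ C
    inC-pos {v} pos with v ∈? C
    ... | yes v∈C = v∈C

    inC≤1 : ∀ v → inC v ≤ 1
    inC≤1 v with v ∈? C
    ... | yes _ = ≤-refl
    ... | no  _ = z≤n

    edge-hits : ∀ {u v} → u ∈ C ⊎ v ∈ C → 1 ≤ inC u + inC v
    edge-hits {u} {v} (inj₁ u∈C) with u ∈? C
    ... | yes _   = s≤s z≤n
    ... | no  u∉C = contradiction u∈C u∉C
    edge-hits {u} {v} (inj₂ v∈C) with v ∈? C
    ... | yes _   = m≤n+m 1 (inC u)
    ... | no  v∉C = contradiction v∈C v∉C

    covered-edges : (M : List (Fin n × Fin n)) → All (λ (u , v) → u ∈ C ⊎ v ∈ C) M →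
                    length M ≤ ∑ (endpoints M) inC
    covered-edges []      []                  = z≤n
    covered-edges ((u , v) ∷ M) (hit ∷ hits) =
      ≤-trans (+-mono-≤ (edge-hits hit) (covered-edges M hits))
              (≤-reflexive (+-assoc (inC u) (inC v) _))

    matching≤cover : ∀ {H : Graph n} (M : List (Fin n × Fin n)) → IsMatching H M →
                     (∀ {u v} → adj H u v ≡ true → u ∈ C ⊎ v ∈ C) → length M ≤ length C
    matching≤cover M (M⊆H , disjoint) covers = begin
      length M              ≤⟨ covered-edges M (All.map covers M⊆H) ⟩
      ∑ (endpoints M) inC   ≤⟨ ∑-≤-of-support inC disjoint (λ _ → inC-pos) ⟩
      ∑ C inC               ≤⟨ ∑-mono C (λ {v} _ → inC≤1 v) ⟩
      ∑ C (λ _ → 1)         ≡⟨ ∑-const-1 C ⟩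
      length C              ∎
      where open ≤-Reasoning

open import Data.Integer using (+_)
open import Data.Rational using (ℚ; _/_; _+_; _*_; _≤_; _<_; 0ℚ; 1ℚ)

module NatToRational where

  import Data.Nat as ℕ
  import Data.Nat.Coprimality as Coprime
  import Data.Integer as ℤ
  import Data.Integer.Properties as ℤ
  open import Data.Rational using (mkℚ; toℚᵘ; *≤*)
  open import Data.Rational.Properties
  import Data.Rational.Unnormalised as ℚᵘ
  import Data.Rational.Unnormalised.Properties as ℚᵘ
  open import Data.List using ([]; _∷_)
  open import Data.List.Membership.Propositional using (_∈_)
  open import Data.List.Relation.Unary.Any using (here; there)
  open import Function using (_∘_)
  open import Relation.Binary.PropositionalEquality
  open ListSum using (∑)

  ℕ→ℚ≡mkℚ : ∀ k → ℕ→ℚ k ≡ mkℚ (+ k) 0 (Coprime.sym (Coprime.1-coprimeTo k))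
  ℕ→ℚ≡mkℚ k = normalize-coprime (Coprime.sym (Coprime.1-coprimeTo k))

  ℕ→ℚ-+ : ∀ a b → ℕ→ℚ (a ℕ.+ b) ≡ ℕ→ℚ a + ℕ→ℚ b
  ℕ→ℚ-+ a b = toℚᵘ-injective (ℚᵘ.≃-trans unnormalised (ℚᵘ.≃-sym (toℚᵘ-homo-+ (ℕ→ℚ a) (ℕ→ℚ b))))
    where
    unnormalised : toℚᵘ (ℕ→ℚ (a ℕ.+ b)) ℚᵘ.≃ toℚᵘ (ℕ→ℚ a) ℚᵘ.+ toℚᵘ (ℕ→ℚ b)
    unnormalised rewrite ℕ→ℚ≡mkℚ (a ℕ.+ b) | ℕ→ℚ≡mkℚ a | ℕ→ℚ≡mkℚ b =
      ℚᵘ.*≡* (cong (ℤ._* + 1) (begin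
        + (a ℕ.+ b)                 ≡⟨ ℤ.pos-+ a b ⟩
        + a ℤ.+ + b                 ≡⟨ cong₂ ℤ._+_ (ℤ.*-identityʳ (+ a)) (ℤ.*-identityʳ (+ b)) ⟨
        + a ℤ.* + 1 ℤ.+ + b ℤ.* + 1 ∎))
      where open ≡-Reasoning

  ℕ→ℚ-mono-≤ : ∀ {a b} → a ℕ.≤ b → ℕ→ℚ a ≤ ℕ→ℚ b
  ℕ→ℚ-mono-≤ {a} {b} a≤b rewrite ℕ→ℚ≡mkℚ a | ℕ→ℚ≡mkℚ b =
    *≤* (ℤ.*-monoʳ-≤-nonNeg (+ 1) (ℤ.+≤+ a≤b))

  ℕ→ℚ-suc-* : ∀ k q → ℕ→ℚ (ℕ.suc k) * q ≡ q + ℕ→ℚ k * q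
  ℕ→ℚ-suc-* k q = begin
    ℕ→ℚ (ℕ.suc k) * q       ≡⟨ cong (_* q) (ℕ→ℚ-+ 1 k) ⟩
    (1ℚ + ℕ→ℚ k) * q        ≡⟨ *-distribʳ-+ q 1ℚ (ℕ→ℚ k) ⟩
    1ℚ * q + ℕ→ℚ k * q      ≡⟨ cong (_+ ℕ→ℚ k * q) (*-identityˡ q) ⟩
    q + ℕ→ℚ k * q           ∎
    where open ≡-Reasoning

  module _ {X : Set} {f : X → ℕ} {q : ℚ} where

    length*≤∑ : ∀ A → (∀ {x} → x ∈ A → q ≤ ℕ→ℚ (f x)) → ℕ→ℚ (length A) * q ≤ ℕ→ℚ (∑ A f)
    length*≤∑ []      _   = ≤-reflexive (*-zeroˡ q)
    length*≤∑ (x ∷ A) q≤f = begin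
      ℕ→ℚ (length (x ∷ A)) * q    ≡⟨ ℕ→ℚ-suc-* (length A) q ⟩
      q + ℕ→ℚ (length A) * q      ≤⟨ +-mono-≤ (q≤f (here refl)) (length*≤∑ A (q≤f ∘ there)) ⟩
      ℕ→ℚ (f x) + ℕ→ℚ (∑ A f)     ≡⟨ ℕ→ℚ-+ (f x) (∑ A f) ⟨
      ℕ→ℚ (∑ (x ∷ A) f)           ∎
      where open ≤-Reasoning

    ∑≤length* : ∀ A → (∀ {x} → x ∈ A → ℕ→ℚ (f x) ≤ q) → ℕ→ℚ (∑ A f) ≤ ℕ→ℚ (length A) * q
    ∑≤length* []      _   = ≤-reflexive (sym (*-zeroˡ q))
    ∑≤length* (x ∷ A) f≤q = begin
      ℕ→ℚ (∑ (x ∷ A) f)           ≡⟨ ℕ→ℚ-+ (f x) (∑ A f) ⟩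
      ℕ→ℚ (f x) + ℕ→ℚ (∑ A f)     ≤⟨ +-mono-≤ (f≤q (here refl)) (∑≤length* A (f≤q ∘ there)) ⟩
      q + ℕ→ℚ (length A) * q      ≡⟨ ℕ→ℚ-suc-* (length A) q ⟨
      ℕ→ℚ (length (x ∷ A)) * q    ∎
      where open ≤-Reasoning

module KernelArithmetic where

  import Data.Nat as ℕ
  open import Data.Rational using (_-_; -_; Positive; positive; nonNegative)
  open import Data.Rational.Properties
  open import Data.Rational.Solver using (module +-*-Solver)
  open import Relation.Binary.PropositionalEquality
  open import Relation.Nullary.Decidable using (toWitness)
  open NatToRational using (ℕ→ℚ-+; ℕ→ℚ-mono-≤)
  open +-*-Solver

  p≤q⇒0≤q-p : ∀ {p q} → p ≤ q → 0ℚ ≤ q - p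
  p≤q⇒0≤q-p {p} {q} p≤q = subst₂ _≤_ (+-inverseˡ p) (+-comm (- p) q) (+-monoʳ-≤ (- p) p≤q)

  p<q⇒0<q-p : ∀ {p q} → p < q → 0ℚ < q - p
  p<q⇒0<q-p {p} {q} p<q = subst₂ _<_ (+-inverseˡ p) (+-comm (- p) q) (+-monoʳ-< (- p) p<q)

  0≤p⇒q≤q+p : ∀ {p} q → 0ℚ ≤ p → q ≤ q + p
  0≤p⇒q≤q+p {p} q 0≤p = subst (_≤ q + p) (+-identityʳ q) (+-monoʳ-≤ q 0≤p)

  0≤*0≤⇒0≤ : ∀ {p q} → 0ℚ ≤ p → 0ℚ ≤ q → 0ℚ ≤ p * q
  0≤*0≤⇒0≤ {p} {q} 0≤p 0≤q =
    nonNegative⁻¹ (p * q) {{nonNeg*nonNeg⇒nonNeg p {{nonNegative 0≤p}} q {{nonNegative 0≤q}}}}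

  -- Dividing by (1 - ε)c, then using (1 + ε)/(1 - ε) ≤ 1 + 3ε, which is ε(1 - 3ε) ≥ 0.
  kernel-ratio : ∀ {x y c ε} → 0ℚ ≤ y → 0ℚ < c → 0ℚ ≤ ε → ε < (+ 1) / 3 →
                 x * ((1ℚ - ε) * c) ≤ y * ((1ℚ + ε) * c) → x ≤ y * (1ℚ + ℕ→ℚ 3 * ε)
  kernel-ratio {x} {y} {c} {ε} 0≤y 0<c 0≤ε ε<⅓ bound =
    *-cancelʳ-≤-pos (1ℚ - ε) (begin
      x * (1ℚ - ε)                               ≤⟨ bound′ ⟩
      y * (1ℚ + ε)                               ≤⟨ 0≤p⇒q≤q+p _ (0≤*0≤⇒0≤ 0≤y (0≤*0≤⇒0≤ 0≤ε 0≤1-3ε)) ⟩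
      y * (1ℚ + ε) + y * (ε * (1ℚ - ℕ→ℚ 3 * ε))  ≡⟨ expand ⟩
      y * (1ℚ + ℕ→ℚ 3 * ε) * (1ℚ - ε)            ∎)
    where
    open ≤-Reasoning
    3ε<1 : ℕ→ℚ 3 * ε < 1ℚ
    3ε<1 = *-monoʳ-<-pos (ℕ→ℚ 3) ε<⅓
    0≤1-3ε : 0ℚ ≤ 1ℚ - ℕ→ℚ 3 * ε
    0≤1-3ε = p≤q⇒0≤q-p (<⇒≤ 3ε<1)
    instance
      c>0 : Positive c
      c>0 = positive 0<c
      1-ε>0 : Positive (1ℚ - ε)
      1-ε>0 = positive (p<q⇒0<q-p (<-trans ε<⅓ (toWitness {a? = (+ 1) / 3 <? 1ℚ} _)))
    bound′ : x * (1ℚ - ε) ≤ y * (1ℚ + ε)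
    bound′ = *-cancelʳ-≤-pos c
               (subst₂ _≤_ (sym (*-assoc x (1ℚ - ε) c)) (sym (*-assoc y (1ℚ + ε) c)) bound)
    expand : y * (1ℚ + ε) + y * (ε * (1ℚ - ℕ→ℚ 3 * ε)) ≡ y * (1ℚ + ℕ→ℚ 3 * ε) * (1ℚ - ε)
    expand = solve 2 (λ y ε → y :* (con 1ℚ :+ ε) :+ y :* (ε :* (con 1ℚ :- con (ℕ→ℚ 3) :* ε))
                              := y :* (con 1ℚ :+ con (ℕ→ℚ 3) :* ε) :* (con 1ℚ :- ε)) refl y ε

  approximation-bound : ∀ {c ε} {m m′ s t : ℕ} → 1ℚ ≤ c → 0ℚ ≤ ε → ε < (+ 1) / 3 →
    s ≡ m ℕ.+ m → m′ ℕ.≤ s ℕ.+ t → ℕ→ℚ t * ((1ℚ - ε) * c) ≤ ℕ→ℚ s * ((1ℚ + ε) * c) →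
    ℕ→ℚ m′ ≤ (ℕ→ℚ 4 + ℕ→ℚ 6 * ε) * ℕ→ℚ m
  approximation-bound {ε = ε} {m} {m′} {s} {t} 1≤c 0≤ε ε<⅓ s≡m+m m′≤s+t bound = begin
    ℕ→ℚ m′                                  ≤⟨ ℕ→ℚ-mono-≤ m′≤s+t ⟩
    ℕ→ℚ (s ℕ.+ t)                           ≡⟨ ℕ→ℚ-+ s t ⟩
    ℕ→ℚ s + ℕ→ℚ t                           ≤⟨ +-monoʳ-≤ (ℕ→ℚ s) t≤ ⟩
    ℕ→ℚ s + ℕ→ℚ s * (1ℚ + ℕ→ℚ 3 * ε)        ≡⟨ cong (λ S → S + S * (1ℚ + ℕ→ℚ 3 * ε)) s≡2m ⟩
    M₂ + M₂ * (1ℚ + ℕ→ℚ 3 * ε)              ≡⟨ collect ⟩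
    (ℕ→ℚ 4 + ℕ→ℚ 6 * ε) * ℕ→ℚ m              ∎
    where
    open ≤-Reasoning
    M₂ = ℕ→ℚ m + ℕ→ℚ m
    s≡2m : ℕ→ℚ s ≡ M₂
    s≡2m = trans (cong ℕ→ℚ s≡m+m) (ℕ→ℚ-+ m m)
    t≤ : ℕ→ℚ t ≤ ℕ→ℚ s * (1ℚ + ℕ→ℚ 3 * ε)
    t≤ = kernel-ratio (ℕ→ℚ-mono-≤ {0} {s} ℕ.z≤n) (<-≤-trans (positive⁻¹ 1ℚ) 1≤c) 0≤ε ε<⅓ bound
    collect : M₂ + M₂ * (1ℚ + ℕ→ℚ 3 * ε) ≡ (ℕ→ℚ 4 + ℕ→ℚ 6 * ε) * ℕ→ℚ m
    collect = solve 2 (λ m ε → (m :+ m) :+ (m :+ m) :* (con 1ℚ :+ con (ℕ→ℚ 3) :* ε)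
                               := (con (ℕ→ℚ 4) :+ con (ℕ→ℚ 6) :* ε) :* m) refl (ℕ→ℚ m) ε

module KernelMatching {n : ℕ} (G : Graph n) {ε c : ℚ} (K : Kernel G ε c)
                      (M : List (Fin n × Fin n)) (maximal : IsMaximalMatching (κ K) M) where

  import Data.Nat as ℕ
  import Data.Nat.Properties as ℕ
  open import Data.Bool using (true; false)
  open import Data.Bool.Properties using () renaming (_≟_ to _≟ᵇ_)
  open import Data.Fin using (_≟_)
  open import Data.List using (_++_; filter; allFin)
  open import Data.List.Properties using (length-++)
  open import Data.List.Membership.Propositional using (_∈_; _∉_)
  open import Data.List.Membership.Propositional.Properties
    using (∈-allFin; ∈-filter⁺; ∈-filter⁻; ∈-++⁺ˡ; ∈-++⁺ʳ)
  open import Data.List.Membership.DecPropositional (_≟_ {n}) using (_∈?_)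
  open import Data.List.Relation.Unary.Unique.Propositional.Properties using (allFin⁺; filter⁺)
  open import Data.Product using (_,_; proj₁; proj₂)
  open import Data.Rational using (_-_)
  open import Data.Rational.Properties using (module ≤-Reasoning)
  open import Function using (_∘_)
  open import Data.Sum using (_⊎_; inj₁; inj₂)
  open import Relation.Binary.PropositionalEquality
  open import Relation.Nullary using (yes; no; ¬?; _×-dec_; contradiction)
  open import Relation.Unary using (Decidable)
  open ListSum using (∑)
  open MatchingCounting
  open NatToRational

  matched : List (Fin n)
  matched = endpoints M

  UnmatchedTight : Fin n → Set
  UnmatchedTight v = tight K v ≡ true × v ∉ matched

  unmatchedTight? : Decidable UnmatchedTight
  unmatchedTight? v = (tight K v ≟ᵇ true) ×-dec ¬? (v ∈? matched)

  unmatchedTight : List (Fin n)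
  unmatchedTight = filter unmatchedTight? (allFin n)

  unmatchedTight⁻ : ∀ {v} → v ∈ unmatchedTight → UnmatchedTight v
  unmatchedTight⁻ v∈ = proj₂ (∈-filter⁻ unmatchedTight? {xs = allFin n} v∈)

  unmatchedTight⁺ : ∀ {v} → UnmatchedTight v → v ∈ unmatchedTight
  unmatchedTight⁺ {v} = ∈-filter⁺ unmatchedTight? (∈-allFin v)

  -- An edge between two unmatched slack vertices is kept in κ (property (iii)), where it
  -- would extend M.
  matched-or-unmatchedTight-cover : ∀ {u v} → adj G u v ≡ true →
    u ∈ matched ++ unmatchedTight ⊎ v ∈ matched ++ unmatchedTight
  matched-or-unmatchedTight-cover {u} {v} uv∈G
    with u ∈? matched | v ∈? matched | tight K u in tu | tight K v in tv
  ... | yes u∈ | _      | _     | _     = inj₁ (∈-++⁺ˡ u∈)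
  ... | no _   | yes v∈ | _     | _     = inj₂ (∈-++⁺ˡ v∈)
  ... | no u∉  | no _   | true  | _     = inj₁ (∈-++⁺ʳ matched (unmatchedTight⁺ (tu , u∉)))
  ... | no _   | no v∉  | false | true  = inj₂ (∈-++⁺ʳ matched (unmatchedTight⁺ (tv , v∉)))
  ... | no u∉  | no v∉  | false | false =
    contradiction (maximal⇒neighbour-matched {H = κ K} maximal u∉ (slackE K u v tu tv uv∈G)) v∉

  matching≤matched+unmatchedTight : ∀ M′ → IsMatching G M′ →
    length M′ ℕ.≤ length matched ℕ.+ length unmatchedTight
  matching≤matched+unmatchedTight M′ matching′ =
    ℕ.≤-trans (matching≤cover (matched ++ unmatchedTight) {H = G} M′ matching′
                                matched-or-unmatchedTight-cover)
              (ℕ.≤-reflexive (length-++ matched))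

  unmatchedTight-bound :
    ℕ→ℚ (length unmatchedTight) * ((1ℚ - ε) * c) ≤ ℕ→ℚ (length matched) * ((1ℚ + ε) * c)
  unmatchedTight-bound = begin
    ℕ→ℚ (length unmatchedTight) * ((1ℚ - ε) * c)
      ≤⟨ length*≤∑ unmatchedTight (lower K _ ∘ proj₁ ∘ unmatchedTight⁻) ⟩
    ℕ→ℚ (∑ unmatchedTight deg)
      ≤⟨ ℕ→ℚ-mono-≤ (∑degree-mono (κ K) (filter⁺ unmatchedTight? (allFin⁺ n)) neighbours-matched) ⟩
    ℕ→ℚ (∑ matched deg)
      ≤⟨ ∑≤length* matched (λ _ → upper K _) ⟩
    ℕ→ℚ (length matched) * ((1ℚ + ε) * c) ∎
    where
    open ≤-Reasoning
    deg : Fin n → ℕ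
    deg = degree (adj (κ K))
    neighbours-matched : ∀ {v u} → v ∈ unmatchedTight → adj (κ K) v u ≡ true → u ∈ matched
    neighbours-matched = maximal⇒neighbour-matched {H = κ K} maximal ∘ proj₂ ∘ unmatchedTight⁻

open KernelArithmetic using (approximation-bound)
open MatchingCounting using (length-endpoints)

theorem3p9 : (n : ℕ) (G : Graph n) (c ε : ℚ) →
    1ℚ ≤ c → 0ℚ ≤ ε → ε < (+ 1) / 3 →
    (K : Kernel G ε c) →
    (M : List (Fin n × Fin n)) → IsMaximalMatching (κ K) M →
    (M′ : List (Fin n × Fin n)) → IsMatching G M′ →
    ℕ→ℚ (length M′) ≤ (ℕ→ℚ 4 + ℕ→ℚ 6 * ε) * ℕ→ℚ (length M)
theorem3p9 n G c ε 1≤c 0≤ε ε<⅓ K M maximal M′ matching′ =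
  approximation-bound {m = length M} 1≤c 0≤ε ε<⅓ (length-endpoints M)
    (matching≤matched+unmatchedTight M′ matching′) unmatchedTight-bound
  where open KernelMatching G K M maximal
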